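{- Let $\mathfrak{g}$ be a symmetrizable Kac–Moody algebra obtained by a diagram folding $\phi\colon\widehat I\to I$ of a simply-laced Kac–Moody algebra $\widehat{\mathfrak{g}}$ with scaling factors $(\gamma_a)_{a\in I}$, and assume that for every dominant integral weight $\lambda$ of $\mathfrak{g}$ the crystal $\mathrm{RC}(\lambda)$ virtualizes in $\mathrm{RC}(\Psi(\lambda))$ via the map $v$ described in the context. Fix $a\in I$. Then the elementary crystal $\mathbf{Z}_{(a)}$ virtualizes in $\widehat{\mathbf{Z}}_{(a)}=\bigotimes_{b\in\phi^{ -1}(a)}\mathbf{Z}_{(b)}$ (for any order of the tensor factors), with virtualization map $z_a(m)\mapsto\bigotimes_{b\in\phi^{ -1}(a)}z_b(\gamma_am)$.
   Context: Folding data: $\widehat{\mathfrak{g}}$ simply-laced with index set $\widehat I$; $\phi\colon\widehat I\to I$ surjective with no two elements of a fiber adjacent in the Dynkin diagram of $\widehat{\mathfrak{g}}$; $\gamma_a\in\mathbf{Z}_{>0}$; $\Psi\colon P\to\widehat P$, $\Lambda_a\mapsto\gamma_a\sum_{b\in\phi^{ -1}(a)}\widehat\Lambda_b$, $\alpha_a\mapsto\gamma_a\sum_{b\in\phi^{ -1}(a)}\widehat\alpha_b$. Virtual crystal: for a $U_q(\widehat{\mathfrak{g}})$-crystal $\widehat B$, a subset $V$ that is an abstract $U_q(\mathfrak{g})$-crystal with $e_a^v=\prod_{b\in\phi^{ -1}(a)}\widehat e_b^{\gamma_a}$, $f_a^v=\prod_{b\in\phi^{ -1}(a)}\widehat f_b^{\gamma_a}$,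 $\varepsilon_a=\gamma_a^{ -1}\widehat\varepsilon_b$, $\varphi_a=\gamma_a^{ -1}\widehat\varphi_b$ for all $b\in\phi^{ -1}(a)$, $\mathrm{wt}=\Psi^{ -1}\circ\widehat{\mathrm{wt}}$; $B$ virtualizes in $\widehat B$ if there is a $U_q(\mathfrak{g})$-crystal isomorphism $B\to V$ onto such a $V$. Rigged configurations for $\mathfrak{g}$ (index set $I$, Cartan matrix $A$, $\langle h_a,\alpha_b\rangle=A_{ab}$): families of finite multisets $(\nu,J)^{(a)}$ of strings $(i,x)$, $i\in\mathbf{Z}_{>0}$, $x\in\mathbf{Z}$, $m_i^{(a)}$ counting strings of length $i$; for a multiplicity array $L$ with $\sum iL_i^{(a)}\Lambda_a=\lambda$, vacancy numbers $p_i^{(a)}=\sum_j\min(i,j)L_j^{(a)}-\sum_{b,j}\frac{A_{ab}}{\gamma_b}\min(\gamma_ai,\gamma_bj)m_j^{(b)}$; colabels $p_i^{(a)}-x$; valid if all labels $\le$ vacancy numbers. Operators (with $x$ the smallest label of $(\nu,J)^{(a)}$): $e_a=0$ if no strings or $x\ge0$, else a minimal-length label-$x$ string $(\ell,x)$ becomes $(\ell-1,x+1)$; $f_a$ adds $(1,-1)$ if no strings or $x>0$, else a maximal-length label-$x$ string becomes $(\ell+1,x-1)$, and $f_a=0$ if the result is invalid; other labels change to keep colabels fixed. $\mathrm{RC}(\lambda)$ is generated from the empty configuration by $e_a,f_a$, with $\mathrm{wt}=\lambda-\sum|\nu^{(a)}|\alpha_a$, $\varepsilon_a=\max\{k\mid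 e_a^k\ne0\}$, $\varphi_a=\varepsilon_a+\langle h_a,\mathrm{wt}\rangle$; $\mathrm{RC}(\Psi(\lambda))$ is the analogous crystal for $\widehat{\mathfrak{g}}$ (all scaling factors $1$). The map $v$ sends $(\nu,J)$ to $(\widehat\nu,\widehat J)$ with $\widehat m^{(b)}_{\gamma_ai}=m^{(a)}_i$ and $\widehat J^{(b)}_{\gamma_ai}=\gamma_aJ^{(a)}_i$ for all $b\in\phi^{ -1}(a)$ (and no other strings). Elementary crystal $\mathbf{Z}_{(a)}=\{z_a(m)\mid m\in\mathbf{Z}\}$: $\mathrm{wt}(z_a(m))=m\alpha_a$, $\varphi_a(z_a(m))=m$, $\varepsilon_a(z_a(m))=-m$, $\varphi_b=\varepsilon_b=-\infty$ for $b\neq a$, $e_az_a(m)=z_a(m+1)$, $f_az_a(m)=z_a(m-1)$, $e_b=f_b=0$ for $b\ne a$. Tensor products: $e_a(b_2\otimes b_1)=e_ab_2\otimes b_1$ if $\varepsilon_a(b_2)>\varphi_a(b_1)$ else $b_2\otimes e_ab_1$; $f_a(b_2\otimes b_1)=f_ab_2\otimes b_1$ if $\varepsilon_a(b_2)\ge\varphi_a(b_1)$ else $b_2\otimes f_ab_1$; $\varepsilon_a(b_2\otimes b_1)=\max(\varepsilon_a(b_2),\varepsilon_a(b_1)-\langle h_a,\mathrm{wt}\,b_2\rangle)$; $\varphi_a(b_2\otimes b_1)=\max(\varphi_a(b_1),\varphi_a(b_2)+\langle h_a,\mathrm{wt}\,b_1\rangle)$; weights add. -}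

module Defs where

open import Data.Nat as ℕ using (ℕ; zero; suc)
open import Data.Integer as ℤ using (ℤ; +_)
open import Data.Rational as ℚ using (ℚ)
open import Data.Fin using (Fin)
open import Data.Fin.Properties using () renaming (_≟_ to _≟F_)
open import Data.List as List using (List; []; _∷_)
open import Data.List.NonEmpty using (List⁺; _∷_)
open import Data.List.Relation.Unary.Unique.Propositional using (Unique)
open import Data.List.Membership.Propositional using (_∈_)
open import Data.Vec as Vec using (Vec)
open import Data.Maybe as Maybe using (Maybe; just; nothing; _>>=_)
open import Data.Product using (Σ; ∃; _×_; _,_; proj₁; proj₂)
open import Data.Sum using (_⊎_)
open import Data.Bool using (Bool; true; false; if_then_else_; _∧_; not)
open import Data.Unit using (⊤)
open import Function.Bundles using (_⇔_)
open import Relation.Nullary using (does; ¬_)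
open import Relation.Binary.PropositionalEquality using (_≡_; _≢_)

sumFin : (n : ℕ) → (Fin n → ℤ) → ℤ
sumFin zero    f = + 0
sumFin (suc n) f = f Fin.zero ℤ.+ sumFin n (λ i → f (Fin.suc i))
  where import Data.Fin as Fin

-- k-fold iteration of a partial operator (0 = nothing)
iterM : {X : Set} → ℕ → (X → Maybe X) → X → Maybe X
iterM zero    g x = just x
iterM (suc k) g x = g x >>= iterM k g

record Folding : Set where
  field
    -- g : symmetrizable Kac–Moody algebra, index set I = Fin n, GCM A
    n       : ℕ
    A       : Fin n → Fin n → ℤ
    A-diag  : ∀ a → A a a ≡ + 2
    A-off   : ∀ a b → a ≢ b → A a b ℤ.≤ + 0
    A-zero  : ∀ a b → A a b ≡ + 0 → A b a ≡ + 0
    A-symz  : Σ (Fin n → ℕ) λ d → (∀ a → 0 ℕ.< d a)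
                × (∀ a b → + d a ℤ.* A a b ≡ + d b ℤ.* A b a)
    -- ĝ : simply-laced Kac–Moody algebra, index set Î = Fin n̂, GCM Â
    n̂       : ℕ
    Â       : Fin n̂ → Fin n̂ → ℤ
    Â-diag  : ∀ b → Â b b ≡ + 2
    Â-sym   : ∀ b c → Â b c ≡ Â c b
    Â-off   : ∀ b c → b ≢ c → Â b c ≡ + 0 ⊎ Â b c ≡ ℤ.- + 1
    φ       : Fin n̂ → Fin n
    φ-surj  : ∀ a → ∃ λ b → φ b ≡ a
    φ-nonadj : ∀ b c → b ≢ c → φ b ≡ φ c → Â b c ≡ + 0
    γ       : Fin n → ℕ
    γ-pos   : ∀ a → 0 ℕ.< γ a

-- Weights.  A weight is recorded by formal coordinates (c , d) standing for
-- Σ_a c_a Λ_a + Σ_a d_a α_a ; equality is coordinatewise.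

Wt : ℕ → Set
Wt n = (Fin n → ℤ) × (Fin n → ℤ)

_≈W_ : {n : ℕ} → Wt n → Wt n → Set
x ≈W y = (∀ a → proj₁ x a ≡ proj₁ y a) × (∀ a → proj₂ x a ≡ proj₂ y a)

_+W_ : {n : ℕ} → Wt n → Wt n → Wt n
x +W y = (λ a → proj₁ x a ℤ.+ proj₁ y a) , (λ a → proj₂ x a ℤ.+ proj₂ y a)

-- ⟨h_a , μ⟩ for the Cartan matrix C: ⟨h_a,Λ_b⟩ = δ_ab, ⟨h_a,α_b⟩ = C_ab
pair : {n : ℕ} → (Fin n → Fin n → ℤ) → Fin n → Wt n → ℤ
pair {n} C a (c , d) = c a ℤ.+ sumFin n (λ b → C a b ℤ.* d b)

data ℤ∞ : Set where
  -∞  : ℤ∞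
  fin : ℤ → ℤ∞

_+∞_ : ℤ∞ → ℤ → ℤ∞
-∞    +∞ k = -∞
fin z +∞ k = fin (z ℤ.+ k)

max∞ : ℤ∞ → ℤ∞ → ℤ∞
max∞ -∞      y       = y
max∞ x       -∞      = x
max∞ (fin x) (fin y) = fin (x ℤ.⊔ y)

_>∞_ : ℤ∞ → ℤ∞ → Bool
-∞    >∞ _     = false
fin x >∞ -∞    = true
fin x >∞ fin y = not (x ℤ.≤ᵇ y)

_≥∞_ : ℤ∞ → ℤ∞ → Bool
_     ≥∞ -∞    = true
-∞    ≥∞ fin y = false
fin x ≥∞ fin y = y ℤ.≤ᵇ x

scale : ℕ → ℤ∞ → ℤ∞
scale k -∞      = -∞
scale k (fin z) = fin (+ k ℤ.* z)

record Crystal (n : ℕ) : Set₁ where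
  field
    Carrier : Set
    e f     : Fin n → Carrier → Maybe Carrier
    ε φ     : Fin n → Carrier → ℤ∞
    wt      : Carrier → Wt n

open Crystal using (Carrier; e; f; ε; wt)

Zcrystal : {n : ℕ} → Fin n → Crystal n
Zcrystal {n} a = record
  { Carrier = ℤ
  ; e  = λ c m → if does (c ≟F a) then just (m ℤ.+ + 1) else nothing
  ; f  = λ c m → if does (c ≟F a) then just (m ℤ.- + 1) else nothing
  ; ε  = λ c m → if does (c ≟F a) then fin (ℤ.- m) else -∞
  ; φ  = λ c m → if does (c ≟F a) then fin m else -∞
  ; wt = λ m → (λ _ → + 0) , (λ c → if does (c ≟F a) then m else + 0)
  }

-- tensor product B₂ ⊗ B₁ (element b₂ ⊗ b₁ written (b₂ , b₁)) for GCM C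
tensor : {n : ℕ} → (Fin n → Fin n → ℤ) → Crystal n → Crystal n → Crystal n
tensor C B₂ B₁ = record
  { Carrier = Carrier B₂ × Carrier B₁
  ; e  = λ a x → if ε B₂ a (proj₁ x) >∞ Crystal.φ B₁ a (proj₂ x)
                 then Maybe.map (λ y → y , proj₂ x) (e B₂ a (proj₁ x))
                 else Maybe.map (λ y → proj₁ x , y) (e B₁ a (proj₂ x))
  ; f  = λ a x → if ε B₂ a (proj₁ x) ≥∞ Crystal.φ B₁ a (proj₂ x)
                 then Maybe.map (λ y → y , proj₂ x) (f B₂ a (proj₁ x))
                 else Maybe.map (λ y → proj₁ x , y) (f B₁ a (proj₂ x))
  ; ε  = λ a x → max∞ (ε B₂ a (proj₁ x))
                      (ε B₁ a (proj₂ x) +∞ (ℤ.- pair C a (wt B₂ (proj₁ x))))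
  ; φ  = λ a x → max∞ (Crystal.φ B₁ a (proj₂ x))
                      (Crystal.φ B₂ a (proj₁ x) +∞ pair C a (wt B₁ (proj₂ x)))
  ; wt = λ x → wt B₂ (proj₁ x) +W wt B₁ (proj₂ x)
  }

tensorZ : {n : ℕ} → (Fin n → Fin n → ℤ) → Fin n → List (Fin n) → Crystal n
tensorZ C b []       = Zcrystal b
tensorZ C b (c ∷ cs) = tensor C (Zcrystal b) (tensorZ C c cs)

diagZ : {n : ℕ} (C : Fin n → Fin n → ℤ) (b : Fin n) (cs : List (Fin n)) →
        ℤ → Carrier (tensorZ C b cs)
diagZ C b []       k = k
diagZ C b (c ∷ cs) k = k , diagZ C c cs k

module _ (F : Folding) where
  open Folding F

  fiber : Fin n → List (Fin n̂)
  fiber a = List.filter (λ b → φ b ≟F a) (List.allFin n̂)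

  eᵛ fᵛ : (B̂ : Crystal n̂) → Fin n → Carrier B̂ → Maybe (Carrier B̂)
  eᵛ B̂ a = List.foldr (λ b k y → iterM (γ a) (e B̂ b) y >>= k) just (fiber a)
  fᵛ B̂ a = List.foldr (λ b k y → iterM (γ a) (f B̂ b) y >>= k) just (fiber a)

  Ψ : Wt n → Wt n̂
  Ψ (c , d) = (λ b → + γ (φ b) ℤ.* c (φ b)) , (λ b → + γ (φ b) ℤ.* d (φ b))

  -- v : B → B̂ (defined on the subcrystal P of B, landing in the subcrystal
  -- P̂ of B̂) is a virtualization map: a U_q(g)-crystal isomorphism from B
  -- onto a virtual crystal V ⊆ B̂.
  record IsVirtualization (B : Crystal n) (B̂ : Crystal n̂)
      (P : Carrier B → Set) (P̂ : Carrier B̂ → Set)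
      (v : Carrier B → Carrier B̂) : Set where
    field
      lands : ∀ x → P x → P̂ (v x)
      inj   : ∀ x y → P x → P y → v x ≡ v y → x ≡ y
      e-com : ∀ a x → P x → Maybe.map v (e B a x) ≡ eᵛ B̂ a (v x)
      f-com : ∀ a x → P x → Maybe.map v (f B a x) ≡ fᵛ B̂ a (v x)
      ε-com : ∀ a b x → P x → φ b ≡ a → ε B̂ b (v x) ≡ scale (γ a) (ε B a x)
      φ-com : ∀ a b x → P x → φ b ≡ a → Crystal.φ B̂ b (v x) ≡ scale (γ a) (Crystal.φ B a x)
      wt-com : ∀ x → P x → Ψ (wt B x) ≈W wt B̂ (v x)

  EnumeratesFiber : Fin n → Fin n̂ → List (Fin n̂) → Set
  EnumeratesFiber a b₀ bs = Unique (b₀ ∷ bs) × (∀ b → (b ∈ (b₀ ∷ bs)) ⇔ (φ b ≡ a))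

  vZ : (a : Fin n) (b₀ : Fin n̂) (bs : List (Fin n̂)) → ℤ → Carrier (tensorZ Â b₀ bs)
  vZ a b₀ bs m = diagZ Â b₀ bs (+ γ a ℤ.* m)

-- A rigged configuration is a Vec (over the index
-- set Fin m) of multisets of strings (i , x); a multiset is stored
-- canonically as a list sorted lexicographically by (length, label).

Str : Set
Str = ℕ × ℚ

Config : ℕ → Set
Config m = Vec (List Str) m

private
  _≤S_ : Str → Str → Bool
  (i , x) ≤S (j , y) = (i ℕ.<ᵇ j) Data.Bool.∨ ((i ℕ.≡ᵇ j) ∧ (x ℚ.≤ᵇ y))
    where import Data.Bool

  _==Q_ : ℚ → ℚ → Bool
  x ==Q y = (x ℚ.≤ᵇ y) ∧ (y ℚ.≤ᵇ x)

  _==S_ : Str → Str → Bool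
  (i , x) ==S (j , y) = (i ℕ.≡ᵇ j) ∧ (x ==Q y)

  fromℕQ : ℕ → ℚ
  fromℕQ k = + k ℚ./ 1

sumℕ : List ℕ → ℕ
sumℕ = List.foldr ℕ._+_ 0

allB : {X : Set} → (X → Bool) → List X → Bool
allB p = List.foldr (λ x r → p x ∧ r) true

insertS : Str → List Str → List Str
insertS s []       = s ∷ []
insertS s (t ∷ ts) = if s ≤S t then s ∷ t ∷ ts else t ∷ insertS s ts

removeS : Str → List Str → List Str
removeS s []       = []
removeS s (t ∷ ts) = if s ==S t then ts else t ∷ removeS s ts

minLabel : List Str → Maybe ℚ
minLabel []       = nothing
minLabel (t ∷ ts) with minLabel ts
... | nothing = just (proj₂ t)
... | just y  = just (proj₂ t ℚ.⊓ y)

-- first string with label x (minimal length, as lists are sorted by length)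
firstWithLabel : ℚ → List Str → Maybe Str
firstWithLabel x []       = nothing
firstWithLabel x (t ∷ ts) = if proj₂ t ==Q x then just t else firstWithLabel x ts

-- last string with label x (maximal length)
lastWithLabel : ℚ → List Str → Maybe Str
lastWithLabel x []       = nothing
lastWithLabel x (t ∷ ts) with lastWithLabel x ts
... | just s  = just s
... | nothing = if proj₂ t ==Q x then just t else nothing

sumQ : List ℚ → ℚ
sumQ = List.foldr ℚ._+_ (+ 0 ℚ./ 1)

sumFinQ : (m : ℕ) → (Fin m → ℚ) → ℚ
sumFinQ zero    g = + 0 ℚ./ 1
sumFinQ (suc m) g = g Fin.zero ℚ.+ sumFinQ m (λ i → g (Fin.suc i))
  where import Data.Fin as Fin

module RiggedConfigurations
    (m : ℕ) (C : Fin m → Fin m → ℤ) (g : Fin m → ℕ) (g-pos : ∀ a → 0 ℕ.< g a)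
    (L : Fin m → List ℕ) where

  vac : Config m → Fin m → ℕ → ℚ
  vac ν a i =
    fromℕQ (sumℕ (List.map (λ j → i ℕ.⊓ j) (L a)))
    ℚ.- sumFinQ m (λ b → sumQ (List.map
          (λ s → ℚ._/_ (C a b ℤ.* + ((g a ℕ.* i) ℕ.⊓ (g b ℕ.* proj₁ s))) (g b)
                        {{ℕ.>-nonZero (g-pos b)}})
          (Vec.lookup ν b)))

  -- remove the string `old` from ν^{(a)}, add the string `new` to ν^{(a)},
  -- and change all other labels so that their colabels stay fixed
  modify : Fin m → Maybe Str → Maybe Str → Config m → Config m
  modify a old new ν = addNew ν₁
    where
      addNew : Config m → Config m
      addNew μ = Maybe.maybe (λ s → Vec.updateAt μ a (insertS s)) μ new
      ν₀ : Config m
      ν₀ = Maybe.maybe (λ s → Vec.updateAt ν a (removeS s)) ν old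
      shape : Config m
      shape = addNew ν₀
      ν₁ : Config m
      ν₁ = Vec.tabulate (λ b → List.map
             (λ s → proj₁ s , proj₂ s ℚ.+ (vac shape b (proj₁ s) ℚ.- vac ν b (proj₁ s)))
             (Vec.lookup ν₀ b))

  valid : Config m → Bool
  valid ν = allB (λ b → allB (λ s → proj₂ s ℚ.≤ᵇ vac ν b (proj₁ s))
                                    (Vec.lookup ν b))
                     (List.allFin m)

  eRC : Fin m → Config m → Maybe (Config m)
  eRC a ν with minLabel (Vec.lookup ν a)
  ... | nothing = nothing
  ... | just x  =
    if (+ 0 ℚ./ 1) ℚ.≤ᵇ x then nothing
    else (firstWithLabel x (Vec.lookup ν a) >>= λ s →
           just (modify a (just s)
                  (if proj₁ s ℕ.≤ᵇ 1 then nothing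
                   else just (proj₁ s ℕ.∸ 1 , x ℚ.+ fromℕQ 1)) ν))

  fCand : Fin m → Config m → Config m
  fCand a ν with minLabel (Vec.lookup ν a)
  ... | nothing = modify a nothing (just (1 , ℚ.- fromℕQ 1)) ν
  ... | just x  =
    if not (x ℚ.≤ᵇ (+ 0 ℚ./ 1))
    then modify a nothing (just (1 , ℚ.- fromℕQ 1)) ν
    else Maybe.maybe
           (λ s → modify a (just s) (just (suc (proj₁ s) , x ℚ.- fromℕQ 1)) ν)
           (modify a nothing (just (1 , ℚ.- fromℕQ 1)) ν)
           (lastWithLabel x (Vec.lookup ν a))

  fRC : Fin m → Config m → Maybe (Config m)
  fRC a ν = if valid (fCand a ν) then just (fCand a ν) else nothing

  emptyRC : Config m
  emptyRC = Vec.replicate m []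

  data Reach : Config m → Set where
    base : Reach emptyRC
    by-e : ∀ {ν ν′} a → Reach ν → eRC a ν ≡ just ν′ → Reach ν′
    by-f : ∀ {ν ν′} a → Reach ν → fRC a ν ≡ just ν′ → Reach ν′

  size : Fin m → Config m → ℕ
  size a ν = sumℕ (List.map proj₁ (Vec.lookup ν a))

  -- ε_a = max { k | e_a^k ν ≠ 0 }; each e_a lowers size a by one, so
  -- size a ν + 1 steps of fuel suffice
  εRC : Fin m → Config m → ℕ
  εRC a ν = go (suc (size a ν)) ν
    where
      go : ℕ → Config m → ℕ
      go zero    μ = 0
      go (suc k) μ = Maybe.maybe (λ μ′ → suc (go k μ′)) 0 (eRC a μ)

  -- wt = λ − Σ_a |ν^{(a)}| α_a  with  λ = Σ_a (Σ_i i L_i^{(a)}) Λ_a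
  wtRC : Config m → Wt m
  wtRC ν = (λ a → + sumℕ (L a)) , (λ a → ℤ.- (+ size a ν))

  RC : Crystal m
  RC = record
    { Carrier = Config m
    ; e  = eRC
    ; f  = fRC
    ; ε  = λ a ν → fin (+ εRC a ν)
    ; φ  = λ a ν → fin (+ εRC a ν ℤ.+ pair C a (wtRC ν))
    ; wt = wtRC
    }

module _ (F : Folding) where
  open Folding F

  -- multiplicity arrays L, given as: L a = the list of lengths i, each i
  -- repeated L_i^{(a)} times.  Its virtual counterpart L̂.
  virtL : (Fin n → List ℕ) → Fin n̂ → List ℕ
  virtL L b = List.map (γ (φ b) ℕ.*_) (L (φ b))

  RCg : (Fin n → List ℕ) → Crystal n
  RCg L = RiggedConfigurations.RC n A γ γ-pos L

  RCĝ : (Fin n → List ℕ) → Crystal n̂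
  RCĝ L = RiggedConfigurations.RC n̂ Â (λ _ → 1) (λ _ → ℕ.s≤s ℕ.z≤n) (virtL L)

  vRC : Config n → Config n̂
  vRC ν = Vec.tabulate (λ b → List.map
            (λ s → γ (φ b) ℕ.* proj₁ s , (+ γ (φ b) ℚ./ 1) ℚ.* proj₂ s)
            (Vec.lookup ν (φ b)))

  RCVirtualizes : Set
  RCVirtualizes = ∀ (L : Fin n → List ℕ) →
    IsVirtualization F (RCg L) (RCĝ L)
      (RiggedConfigurations.Reach n A γ γ-pos L)
      (RiggedConfigurations.Reach n̂ Â (λ _ → 1) (λ _ → ℕ.s≤s ℕ.z≤n) (virtL L))
      vRC

-- In Z_(b₀) ⊗ ⋯ ⊗ Z_(b_k) with the b_j distinct, ê_b and f̂_b act on the factor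
-- z_b alone, because the other factors have ε_b = φ_b = -∞.  The b_j of a fiber
-- of φ are pairwise orthogonal, so the weights of the other factors are invisible
-- to ⟨h_b , –⟩ and ε̂_b, φ̂_b read off the coordinate of z_b as well.  Hence
-- ∏_b ê_b^{γ_a} sends ⊗_b z_b(γ_a m) to ⊗_b z_b(γ_a (m + 1)), the image of e_a z_a(m).
module Submission where

open import Defs
open import Data.Fin using (Fin)
open import Data.List using (List)
open import Data.Unit using (⊤)

import Data.Fin as Fin

open import Data.Nat as ℕ using (ℕ; zero; suc)
open import Data.Integer as ℤ using (ℤ; +_; -_)
import Data.Integer.Properties as ℤ
open import Data.Fin.Properties using () renaming (_≟_ to _≟F_)
open import Data.List as List using ([]; _∷_)
open import Data.List.Relation.Unary.All as All using (All; []; _∷_)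
open import Data.List.Relation.Unary.Any using (here; there)
open import Data.List.Relation.Unary.AllPairs using (_∷_)
open import Data.List.Relation.Unary.Unique.Propositional using (Unique)
import Data.List.Relation.Unary.Unique.Propositional.Properties as Unique
open import Data.List.Membership.Propositional using (_∈_; _∉_)
open import Data.List.Membership.Propositional.Properties using (∈-filter⁺; ∈-filter⁻; ∈-allFin)
open import Data.Maybe as Maybe using (Maybe; just; nothing; _>>=_)
open import Data.Product using (_,_; proj₁; proj₂)
open import Data.Bool using (Bool; true; false; if_then_else_)
open import Function using (_∘_)
open import Function.Bundles using (Equivalence)
open import Relation.Nullary using (does; yes; no)
open import Data.Empty using (⊥-elim)
open import Relation.Binary.PropositionalEquality

if-const : ∀ {X : Set} (c : Bool) {x y z : X} → x ≡ z → y ≡ z → (if c then x else y) ≡ z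
if-const true  x≡z _   = x≡z
if-const false _   y≡z = y≡z

sumFin-zero : ∀ m (h : Fin m → ℤ) → (∀ i → h i ≡ + 0) → sumFin m h ≡ + 0
sumFin-zero zero    h h≡0 = refl
sumFin-zero (suc m) h h≡0
  rewrite h≡0 Fin.zero | sumFin-zero m (λ i → h (Fin.suc i)) (λ i → h≡0 (Fin.suc i)) = refl

Unique-head∉tail : ∀ {A : Set} {x : A} {xs} → Unique (x ∷ xs) → x ∉ xs
Unique-head∉tail (x≢ ∷ _) x∈ = All.lookup x≢ x∈ refl

module _ {m : ℕ} where

  bump : Fin m → ℤ → (Fin m → ℤ) → Fin m → ℤ
  bump b k g c = if does (c ≟F b) then g c ℤ.+ k else g c

  bump-≡ : ∀ b k g → bump b k g b ≡ g b ℤ.+ k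
  bump-≡ b k g with b ≟F b
  ... | yes _  = refl
  ... | no b≢b = ⊥-elim (b≢b refl)

  bump-≢ : ∀ b k g c → c ≢ b → bump b k g c ≡ g c
  bump-≢ b k g c c≢b with c ≟F b
  ... | yes c≡b = ⊥-elim (c≢b c≡b)
  ... | no _    = refl

  bump-+ : ∀ b s t g c → bump b t (bump b s g) c ≡ bump b (s ℤ.+ t) g c
  bump-+ b s t g c with c ≟F b
  ... | yes _ = ℤ.+-assoc (g c) s t
  ... | no _  = refl

  bump-0 : ∀ b g c → bump b (+ 0) g c ≡ g c
  bump-0 b g c with c ≟F b
  ... | yes _ = ℤ.+-identityʳ (g c)
  ... | no _  = refl

  bumpAll : ℤ → List (Fin m) → (Fin m → ℤ) → Fin m → ℤ
  bumpAll k []       g = g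
  bumpAll k (b ∷ bs) g = bumpAll k bs (bump b k g)

  bumpAll-∉ : ∀ k bs g c → c ∉ bs → bumpAll k bs g c ≡ g c
  bumpAll-∉ k []       g c _   = refl
  bumpAll-∉ k (b ∷ bs) g c c∉ =
    trans (bumpAll-∉ k bs (bump b k g) c (c∉ ∘ there)) (bump-≢ b k g c (c∉ ∘ here))

  bumpAll-∈ : ∀ k bs g c → Unique bs → c ∈ bs → bumpAll k bs g c ≡ g c ℤ.+ k
  bumpAll-∈ k (b ∷ bs) g c u (here refl) =
    trans (bumpAll-∉ k bs (bump c k g) c (Unique-head∉tail u)) (bump-≡ c k g)
  bumpAll-∈ k (b ∷ bs) g c u@(_ ∷ u′) (there c∈) =
    trans (bumpAll-∈ k bs (bump b k g) c u′ c∈)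
      (cong (ℤ._+ k) (bump-≢ b k g c (λ { refl → Unique-head∉tail u c∈ })))

-- eᵛ F B̂ a and fᵛ F B̂ a are, definitionally, iterAlong (γ a) (e B̂) (fiber F a)
-- and iterAlong (γ a) (f B̂) (fiber F a).
iterAlong : ∀ {m} {X : Set} → ℕ → (Fin m → X → Maybe X) → List (Fin m) → X → Maybe X
iterAlong k op = List.foldr (λ b κ y → iterM k (op b) y >>= κ) just

iterAlong-undefined : ∀ {m} {X : Set} k (op : Fin m → X → Maybe X) {b} bs → b ∈ bs →
  All (λ d → ∀ y → op d y ≡ nothing) bs → ∀ x → iterAlong (suc k) op bs x ≡ nothing
iterAlong-undefined k op (d ∷ bs) _ (op-d≡nothing ∷ _) x rewrite op-d≡nothing x = refl

module ElementaryTensor {m : ℕ} (C : Fin m → Fin m → ℤ) where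
  open import Data.List.Membership.DecPropositional (_≟F_ {m}) using (_∈?_)

  T : Fin m → List (Fin m) → Crystal m
  T = tensorZ C

  point : ∀ b₀ bs → (Fin m → ℤ) → Crystal.Carrier (T b₀ bs)
  point b₀ []       g = g b₀
  point b₀ (c ∷ cs) g = g b₀ , point c cs g

  point-cong : ∀ b₀ bs g h → (∀ c → c ∈ b₀ ∷ bs → g c ≡ h c) → point b₀ bs g ≡ point b₀ bs h
  point-cong b₀ []       g h g≗h = g≗h b₀ (here refl)
  point-cong b₀ (c ∷ cs) g h g≗h =
    cong₂ _,_ (g≗h b₀ (here refl)) (point-cong c cs g h (λ d d∈ → g≗h d (there d∈)))

  diagZ≡point : ∀ b₀ bs k → diagZ C b₀ bs k ≡ point b₀ bs (λ _ → k)
  diagZ≡point b₀ []       k = refl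
  diagZ≡point b₀ (c ∷ cs) k = cong (k ,_) (diagZ≡point c cs k)

  head : ∀ b₀ bs → Crystal.Carrier (T b₀ bs) → ℤ
  head b₀ []       x       = x
  head b₀ (c ∷ cs) (x , _) = x

  head-point : ∀ b₀ bs g → head b₀ bs (point b₀ bs g) ≡ g b₀
  head-point b₀ []       g = refl
  head-point b₀ (c ∷ cs) g = refl

  Orthogonal : List (Fin m) → Set
  Orthogonal bs = ∀ {b c} → b ∈ bs → c ∈ bs → b ≢ c → C b c ≡ + 0

  e-∉ : ∀ b₀ bs b x → b ∉ b₀ ∷ bs → Crystal.e (T b₀ bs) b x ≡ nothing
  e-∉ b₀ []       b x       b∉ with b ≟F b₀
  ... | yes b≡b₀ = ⊥-elim (b∉ (here b≡b₀))
  ... | no _     = refl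
  e-∉ b₀ (c ∷ cs) b (x , y) b∉ with b ≟F b₀
  ... | yes b≡b₀ = ⊥-elim (b∉ (here b≡b₀))
  ... | no _     = if-const (-∞ >∞ Crystal.φ (T c cs) b y) refl
                     (cong (Maybe.map (x ,_)) (e-∉ c cs b y (λ b∈ → b∉ (there b∈))))

  f-∉ : ∀ b₀ bs b x → b ∉ b₀ ∷ bs → Crystal.f (T b₀ bs) b x ≡ nothing
  f-∉ b₀ []       b x       b∉ with b ≟F b₀
  ... | yes b≡b₀ = ⊥-elim (b∉ (here b≡b₀))
  ... | no _     = refl
  f-∉ b₀ (c ∷ cs) b (x , y) b∉ with b ≟F b₀
  ... | yes b≡b₀ = ⊥-elim (b∉ (here b≡b₀))
  ... | no _     = if-const (-∞ ≥∞ Crystal.φ (T c cs) b y) refl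
                     (cong (Maybe.map (x ,_)) (f-∉ c cs b y (λ b∈ → b∉ (there b∈))))

  ε-∉ : ∀ b₀ bs b x → b ∉ b₀ ∷ bs → Crystal.ε (T b₀ bs) b x ≡ -∞
  ε-∉ b₀ []       b x       b∉ with b ≟F b₀
  ... | yes b≡b₀ = ⊥-elim (b∉ (here b≡b₀))
  ... | no _     = refl
  ε-∉ b₀ (c ∷ cs) b (x , y) b∉ with b ≟F b₀
  ... | yes b≡b₀ = ⊥-elim (b∉ (here b≡b₀))
  ... | no _ rewrite ε-∉ c cs b y (λ b∈ → b∉ (there b∈)) = refl

  φ-∉ : ∀ b₀ bs b x → b ∉ b₀ ∷ bs → Crystal.φ (T b₀ bs) b x ≡ -∞
  φ-∉ b₀ []       b x       b∉ with b ≟F b₀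
  ... | yes b≡b₀ = ⊥-elim (b∉ (here b≡b₀))
  ... | no _     = refl
  φ-∉ b₀ (c ∷ cs) b (x , y) b∉ with b ≟F b₀
  ... | yes b≡b₀ = ⊥-elim (b∉ (here b≡b₀))
  ... | no _ rewrite φ-∉ c cs b y (λ b∈ → b∉ (there b∈)) = refl

  wt-Λ : ∀ b₀ bs x d → proj₁ (Crystal.wt (T b₀ bs) x) d ≡ + 0
  wt-Λ b₀ []       x       d = refl
  wt-Λ b₀ (c ∷ cs) (x , y) d rewrite wt-Λ c cs y d = refl

  wt-α-∉ : ∀ b₀ bs x d → d ∉ b₀ ∷ bs → proj₂ (Crystal.wt (T b₀ bs) x) d ≡ + 0
  wt-α-∉ b₀ []       x       d d∉ with d ≟F b₀
  ... | yes d≡b₀ = ⊥-elim (d∉ (here d≡b₀))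
  ... | no _     = refl
  wt-α-∉ b₀ (c ∷ cs) (x , y) d d∉ with d ≟F b₀
  ... | yes d≡b₀ = ⊥-elim (d∉ (here d≡b₀))
  ... | no _ rewrite wt-α-∉ c cs y d (λ d∈ → d∉ (there d∈)) = refl

  wt-α-∈ : ∀ b₀ bs g d → Unique (b₀ ∷ bs) → d ∈ b₀ ∷ bs →
    proj₂ (Crystal.wt (T b₀ bs) (point b₀ bs g)) d ≡ g d
  wt-α-∈ b₀ []       g d _ (here refl) with d ≟F d
  ... | yes _  = refl
  ... | no d≢d = ⊥-elim (d≢d refl)
  wt-α-∈ b₀ (c ∷ cs) g d u (here refl) with d ≟F d
  ... | no d≢d = ⊥-elim (d≢d refl)
  ... | yes _ rewrite wt-α-∉ c cs (point c cs g) d (Unique-head∉tail u) = ℤ.+-identityʳ (g d)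
  wt-α-∈ b₀ (c ∷ cs) g d u@(_ ∷ u′) (there d∈) with d ≟F b₀
  ... | yes refl = ⊥-elim (Unique-head∉tail u d∈)
  ... | no _ rewrite wt-α-∈ c cs g d u′ d∈ = ℤ.+-identityˡ (g d)

  pair-wt-orthogonal : ∀ b c cs y → (∀ d → d ∈ c ∷ cs → C b d ≡ + 0) →
    pair C b (Crystal.wt (T c cs) y) ≡ + 0
  pair-wt-orthogonal b c cs y C≡0 = cong₂ ℤ._+_ (wt-Λ c cs y b) (sumFin-zero m _ term≡0)
    where
      term≡0 : ∀ d → C b d ℤ.* proj₂ (Crystal.wt (T c cs) y) d ≡ + 0
      term≡0 d with d ∈? (c ∷ cs)
      ... | yes d∈ rewrite C≡0 d d∈ = refl
      ... | no d∉ rewrite wt-α-∉ c cs y d d∉ = ℤ.*-zeroʳ (C b d)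

  φ-∈-finite : ∀ b₀ bs b x → b ∈ b₀ ∷ bs → Crystal.φ (T b₀ bs) b x ≢ -∞
  φ-∈-finite b₀ []       b x (here refl) with b ≟F b
  ... | yes _  = λ ()
  ... | no b≢b = ⊥-elim (b≢b refl)
  φ-∈-finite b₀ (c ∷ cs) b (x , y) (here refl) with b ≟F b | Crystal.φ (T c cs) b y
  ... | no b≢b | _     = ⊥-elim (b≢b refl)
  ... | yes _  | -∞    = λ ()
  ... | yes _  | fin _ = λ ()
  φ-∈-finite b₀ (c ∷ cs) b (x , y) (there b∈)
    with Crystal.φ (T c cs) b y | φ-∈-finite c cs b y b∈
  ... | -∞    | φ≢-∞ = ⊥-elim (φ≢-∞ refl)
  ... | fin _ | _    with Crystal.φ (Zcrystal b₀) b x +∞ pair C b (Crystal.wt (T c cs) y)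
  ...   | -∞    = λ ()
  ...   | fin _ = λ ()

  e-∈ : ∀ b₀ bs b g → Unique (b₀ ∷ bs) → b ∈ b₀ ∷ bs →
    Crystal.e (T b₀ bs) b (point b₀ bs g) ≡ just (point b₀ bs (bump b (+ 1) g))
  e-∈ b₀ []       b g _ (here refl) with b ≟F b
  ... | yes _  = refl
  ... | no b≢b = ⊥-elim (b≢b refl)
  e-∈ b₀ (c ∷ cs) b g u (here refl) with b ≟F b
  ... | no b≢b = ⊥-elim (b≢b refl)
  ... | yes _ rewrite φ-∉ c cs b (point c cs g) (Unique-head∉tail u) =
    cong (λ y → just (g b ℤ.+ + 1 , y)) (point-cong c cs g (bump b (+ 1) g)
      (λ d d∈ → sym (bump-≢ b (+ 1) g d (λ { refl → Unique-head∉tail u d∈ }))))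
  e-∈ b₀ (c ∷ cs) b g u@(_ ∷ u′) (there b∈) with b ≟F b₀
  ... | yes refl = ⊥-elim (Unique-head∉tail u b∈)
  ... | no b≢b₀ rewrite e-∈ c cs b g u′ b∈ =
    cong (λ x → just (x , point c cs (bump b (+ 1) g))) (sym (bump-≢ b (+ 1) g b₀ (b≢b₀ ∘ sym)))

  f-∈ : ∀ b₀ bs b g → Unique (b₀ ∷ bs) → b ∈ b₀ ∷ bs →
    Crystal.f (T b₀ bs) b (point b₀ bs g) ≡ just (point b₀ bs (bump b (- + 1) g))
  f-∈ b₀ []       b g _ (here refl) with b ≟F b
  ... | yes _  = refl
  ... | no b≢b = ⊥-elim (b≢b refl)
  f-∈ b₀ (c ∷ cs) b g u (here refl) with b ≟F b
  ... | no b≢b = ⊥-elim (b≢b refl)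
  ... | yes _ rewrite φ-∉ c cs b (point c cs g) (Unique-head∉tail u) =
    cong (λ y → just (g b ℤ.- + 1 , y)) (point-cong c cs g (bump b (- + 1) g)
      (λ d d∈ → sym (bump-≢ b (- + 1) g d (λ { refl → Unique-head∉tail u d∈ }))))
  f-∈ b₀ (c ∷ cs) b g u@(_ ∷ u′) (there b∈) with b ≟F b₀
  ... | yes refl = ⊥-elim (Unique-head∉tail u b∈)
  ... | no b≢b₀
    with Crystal.φ (T c cs) b (point c cs g) | φ-∈-finite c cs b (point c cs g) b∈
  ...   | -∞    | φ≢-∞ = ⊥-elim (φ≢-∞ refl)
  ...   | fin _ | _ rewrite f-∈ c cs b g u′ b∈ =
    cong (λ x → just (x , point c cs (bump b (- + 1) g))) (sym (bump-≢ b (- + 1) g b₀ (b≢b₀ ∘ sym)))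

  ε-∈ : ∀ b₀ bs b g → Unique (b₀ ∷ bs) → Orthogonal (b₀ ∷ bs) → b ∈ b₀ ∷ bs →
    Crystal.ε (T b₀ bs) b (point b₀ bs g) ≡ fin (- g b)
  ε-∈ b₀ []       b g _ _ (here refl) with b ≟F b
  ... | yes _  = refl
  ... | no b≢b = ⊥-elim (b≢b refl)
  ε-∈ b₀ (c ∷ cs) b g u _ (here refl) with b ≟F b
  ... | no b≢b = ⊥-elim (b≢b refl)
  ... | yes _ rewrite ε-∉ c cs b (point c cs g) (Unique-head∉tail u) = refl
  ε-∈ b₀ (c ∷ cs) b g u@(_ ∷ u′) orth (there b∈) with b ≟F b₀
  ... | yes refl = ⊥-elim (Unique-head∉tail u b∈)
  ... | no b≢b₀
    rewrite ε-∈ c cs b g u′ (λ p q → orth (there p) (there q)) b∈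
          | pair-wt-orthogonal b b₀ [] (g b₀) (λ { d (here refl) → orth (there b∈) (here refl) b≢b₀ })
    = cong fin (ℤ.+-identityʳ (- g b))

  φ-∈ : ∀ b₀ bs b g → Unique (b₀ ∷ bs) → Orthogonal (b₀ ∷ bs) → b ∈ b₀ ∷ bs →
    Crystal.φ (T b₀ bs) b (point b₀ bs g) ≡ fin (g b)
  φ-∈ b₀ []       b g _ _ (here refl) with b ≟F b
  ... | yes _  = refl
  ... | no b≢b = ⊥-elim (b≢b refl)
  φ-∈ b₀ (c ∷ cs) b g u orth (here refl) with b ≟F b
  ... | no b≢b = ⊥-elim (b≢b refl)
  ... | yes _
    rewrite φ-∉ c cs b (point c cs g) (Unique-head∉tail u)
          | pair-wt-orthogonal b c cs (point c cs g)
              (λ d d∈ → orth (here refl) (there d∈) (λ { refl → Unique-head∉tail u d∈ }))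
    = cong fin (ℤ.+-identityʳ (g b))
  φ-∈ b₀ (c ∷ cs) b g u@(_ ∷ u′) orth (there b∈) with b ≟F b₀
  ... | yes refl = ⊥-elim (Unique-head∉tail u b∈)
  ... | no _ rewrite φ-∈ c cs b g u′ (λ p q → orth (there p) (there q)) b∈ = refl

  iterM-point : ∀ b₀ bs (op : Crystal.Carrier (T b₀ bs) → Maybe (Crystal.Carrier (T b₀ bs))) b s →
    (∀ h → op (point b₀ bs h) ≡ just (point b₀ bs (bump b s h))) →
    ∀ k g → iterM k op (point b₀ bs g) ≡ just (point b₀ bs (bump b (+ k ℤ.* s) g))
  iterM-point b₀ bs op b s op-point zero g =
    cong just (point-cong b₀ bs _ _ (λ c _ → sym (bump-0 b g c)))
  iterM-point b₀ bs op b s op-point (suc k) g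
    rewrite op-point g | iterM-point b₀ bs op b s op-point k (bump b s g) =
    cong just (point-cong b₀ bs _ _ λ c _ →
      trans (bump-+ b s (+ k ℤ.* s) g c) (cong (λ t → bump b t g c) (sym (ℤ.suc-* (+ k) s))))

  iterAlong-point : ∀ b₀ bs op s k →
    (∀ b → b ∈ b₀ ∷ bs → ∀ h → op b (point b₀ bs h) ≡ just (point b₀ bs (bump b s h))) →
    ∀ L → All (_∈ b₀ ∷ bs) L → ∀ g →
    iterAlong k op L (point b₀ bs g) ≡ just (point b₀ bs (bumpAll (+ k ℤ.* s) L g))
  iterAlong-point b₀ bs op s k op-point []      []         g = refl
  iterAlong-point b₀ bs op s k op-point (b ∷ L) (b∈ ∷ L⊆) g
    rewrite iterM-point b₀ bs (op b) b s (op-point b b∈) k g =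
    iterAlong-point b₀ bs op s k op-point L L⊆ _

module _ (F : Folding) where
  open Folding F
  open ElementaryTensor Â

  Unique-fiber : ∀ a → Unique (fiber F a)
  Unique-fiber a = Unique.filter⁺ (λ b → φ b ≟F a) (Unique.allFin⁺ n̂)

  ∈-fiber⁺ : ∀ {a c} → φ c ≡ a → c ∈ fiber F a
  ∈-fiber⁺ {a} {c} = ∈-filter⁺ (λ b → φ b ≟F a) (∈-allFin c)

  ∈-fiber⁻ : ∀ {a c} → c ∈ fiber F a → φ c ≡ a
  ∈-fiber⁻ {a} c∈ = proj₂ (∈-filter⁻ (λ b → φ b ≟F a) {xs = List.allFin n̂} c∈)

  iterAlong-fiber-undefined : ∀ {X : Set} (op : Fin n̂ → X → Maybe X) c →
    (∀ d → φ d ≡ c → ∀ y → op d y ≡ nothing) → ∀ x → iterAlong (γ c) op (fiber F c) x ≡ nothing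
  iterAlong-fiber-undefined op c op≡nothing x with γ c | γ-pos c
  ... | suc k | _ = iterAlong-undefined k op (fiber F c) (∈-fiber⁺ (proj₂ (φ-surj c)))
                      (All.tabulate (λ d∈ → op≡nothing _ (∈-fiber⁻ d∈))) x

  module Virtual (a : Fin n) (b₀ : Fin n̂) (bs : List (Fin n̂)) (enum : EnumeratesFiber F a b₀ bs) where

    B̂ : Crystal n̂
    B̂ = T b₀ bs

    v : ℤ → Crystal.Carrier B̂
    v = vZ F a b₀ bs

    unique : Unique (b₀ ∷ bs)
    unique = proj₁ enum

    ∈-enum⇒φ : ∀ {c} → c ∈ b₀ ∷ bs → φ c ≡ a
    ∈-enum⇒φ {c} = Equivalence.to (proj₂ enum c)

    φ⇒∈-enum : ∀ {c} → φ c ≡ a → c ∈ b₀ ∷ bs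
    φ⇒∈-enum {c} = Equivalence.from (proj₂ enum c)

    orthogonal : Orthogonal (b₀ ∷ bs)
    orthogonal b∈ c∈ b≢c = φ-nonadj _ _ b≢c (trans (∈-enum⇒φ b∈) (sym (∈-enum⇒φ c∈)))

    v≡point : ∀ x → v x ≡ point b₀ bs (λ _ → + γ a ℤ.* x)
    v≡point x = diagZ≡point b₀ bs (+ γ a ℤ.* x)

    iterAlong-fiber-v : ∀ (op : Fin n̂ → Crystal.Carrier B̂ → Maybe (Crystal.Carrier B̂)) s →
      (∀ b → b ∈ b₀ ∷ bs → ∀ h → op b (point b₀ bs h) ≡ just (point b₀ bs (bump b s h))) →
      ∀ x → iterAlong (γ a) op (fiber F a) (v x) ≡ just (v (x ℤ.+ s))
    iterAlong-fiber-v op s op-point x = begin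
      iterAlong (γ a) op (fiber F a) (v x)
        ≡⟨ cong (iterAlong (γ a) op (fiber F a)) (v≡point x) ⟩
      iterAlong (γ a) op (fiber F a) (point b₀ bs (λ _ → + γ a ℤ.* x))
        ≡⟨ iterAlong-point b₀ bs op s (γ a) op-point (fiber F a)
             (All.tabulate (φ⇒∈-enum ∘ ∈-fiber⁻)) _ ⟩
      just (point b₀ bs (bumpAll (+ γ a ℤ.* s) (fiber F a) (λ _ → + γ a ℤ.* x)))
        ≡⟨ cong just (point-cong b₀ bs _ _ λ c c∈ → begin
             bumpAll (+ γ a ℤ.* s) (fiber F a) (λ _ → + γ a ℤ.* x) c
               ≡⟨ bumpAll-∈ _ (fiber F a) _ c (Unique-fiber a) (∈-fiber⁺ (∈-enum⇒φ c∈)) ⟩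
             + γ a ℤ.* x ℤ.+ + γ a ℤ.* s
               ≡⟨ ℤ.*-distribˡ-+ (+ γ a) x s ⟨
             + γ a ℤ.* (x ℤ.+ s) ∎) ⟩
      just (point b₀ bs (λ _ → + γ a ℤ.* (x ℤ.+ s)))
        ≡⟨ cong just (v≡point (x ℤ.+ s)) ⟨
      just (v (x ℤ.+ s)) ∎
      where open ≡-Reasoning

    iterAlong-fiber-other : ∀ (op : Fin n̂ → Crystal.Carrier B̂ → Maybe (Crystal.Carrier B̂)) →
      (∀ d → d ∉ b₀ ∷ bs → ∀ y → op d y ≡ nothing) →
      ∀ c → c ≢ a → ∀ y → iterAlong (γ c) op (fiber F c) y ≡ nothing
    iterAlong-fiber-other op op-∉ c c≢a = iterAlong-fiber-undefined op c
      (λ d φd≡c → op-∉ d (λ d∈ → c≢a (trans (sym φd≡c) (∈-enum⇒φ d∈))))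

    v-injective : ∀ x y → v x ≡ v y → x ≡ y
    v-injective x y vx≡vy = ℤ.*-cancelˡ-≡ (+ γ a) x y {{ℕ.>-nonZero (γ-pos a)}} (begin
      + γ a ℤ.* x                            ≡⟨ head-point b₀ bs _ ⟨
      head b₀ bs (point b₀ bs (λ _ → _))     ≡⟨ cong (head b₀ bs) (trans (sym (v≡point x)) (trans vx≡vy (v≡point y))) ⟩
      head b₀ bs (point b₀ bs (λ _ → _))     ≡⟨ head-point b₀ bs _ ⟩
      + γ a ℤ.* y                            ∎)
      where open ≡-Reasoning

    v-e : ∀ c x → Maybe.map v (Crystal.e (Zcrystal a) c x) ≡ eᵛ F B̂ c (v x)
    v-e c x with c ≟F a
    ... | yes refl = sym (iterAlong-fiber-v (Crystal.e B̂) (+ 1) (λ b b∈ h → e-∈ b₀ bs b h unique b∈) x)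
    ... | no c≢a   = sym (iterAlong-fiber-other (Crystal.e B̂) (λ d d∉ y → e-∉ b₀ bs d y d∉) c c≢a (v x))

    v-f : ∀ c x → Maybe.map v (Crystal.f (Zcrystal a) c x) ≡ fᵛ F B̂ c (v x)
    v-f c x with c ≟F a
    ... | yes refl = sym (iterAlong-fiber-v (Crystal.f B̂) (- + 1) (λ b b∈ h → f-∈ b₀ bs b h unique b∈) x)
    ... | no c≢a   = sym (iterAlong-fiber-other (Crystal.f B̂) (λ d d∉ y → f-∉ b₀ bs d y d∉) c c≢a (v x))

    v-ε : ∀ c b x → φ b ≡ c → Crystal.ε B̂ b (v x) ≡ scale (γ c) (Crystal.ε (Zcrystal a) c x)
    v-ε c b x φb≡c with c ≟F a
    ... | yes refl rewrite v≡point x =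
      trans (ε-∈ b₀ bs b _ unique orthogonal (φ⇒∈-enum φb≡c)) (cong fin (ℤ.neg-distribʳ-* (+ γ a) x))
    ... | no c≢a = ε-∉ b₀ bs b (v x) (λ b∈ → c≢a (trans (sym φb≡c) (∈-enum⇒φ b∈)))

    v-φ : ∀ c b x → φ b ≡ c → Crystal.φ B̂ b (v x) ≡ scale (γ c) (Crystal.φ (Zcrystal a) c x)
    v-φ c b x φb≡c with c ≟F a
    ... | yes refl rewrite v≡point x = φ-∈ b₀ bs b _ unique orthogonal (φ⇒∈-enum φb≡c)
    ... | no c≢a = φ-∉ b₀ bs b (v x) (λ b∈ → c≢a (trans (sym φb≡c) (∈-enum⇒φ b∈)))

    v-wt : ∀ x → Ψ F (Crystal.wt (Zcrystal a) x) ≈W Crystal.wt B̂ (v x)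
    v-wt x = (λ d → trans (ℤ.*-zeroʳ (+ γ (φ d))) (sym (wt-Λ b₀ bs (v x) d))) , wt-α
      where
        wt-α : ∀ d → proj₂ (Ψ F (Crystal.wt (Zcrystal a) x)) d ≡ proj₂ (Crystal.wt B̂ (v x)) d
        wt-α d with φ d ≟F a
        ... | yes refl rewrite v≡point x = sym (wt-α-∈ b₀ bs _ d unique (φ⇒∈-enum refl))
        ... | no φd≢a = trans (ℤ.*-zeroʳ (+ γ (φ d)))
                          (sym (wt-α-∉ b₀ bs (v x) d (φd≢a ∘ ∈-enum⇒φ)))

lemma5p17 : (F : Folding) → RCVirtualizes F →
    (a : Fin (Folding.n F)) (b₀ : Fin (Folding.n̂ F)) (bs : List (Fin (Folding.n̂ F))) →
    EnumeratesFiber F a b₀ bs →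
    IsVirtualization F (Zcrystal a) (tensorZ (Folding.Â F) b₀ bs)
      (λ _ → ⊤) (λ _ → ⊤) (vZ F a b₀ bs)
lemma5p17 F _ a b₀ bs enum = record
  { lands  = λ _ _ → _
  ; inj    = λ x y _ _ → v-injective x y
  ; e-com  = λ c x _ → v-e c x
  ; f-com  = λ c x _ → v-f c x
  ; ε-com  = λ c b x _ → v-ε c b x
  ; φ-com  = λ c b x _ → v-φ c b x
  ; wt-com = λ x _ → v-wt x
  }
  where open Virtual F a b₀ bs enum
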